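{- A permutation $\pi$ belongs to $\operatorname{Av}(2143,3142,4132)$ if and only if the sequence obtained from $\pi$ by deleting the entries $\pi_i$ at all leading maxima $i$ is order-isomorphic to a $132$-avoiding permutation.
   Context: For a permutation $\pi$, an index $i$ is an LR-maximum if $\pi_j<\pi_i$ for all $j<i$; an index $i$ is a leading maximum if every index in $\{1,\dots,i\}$ is an LR-maximum (equivalently $\pi_1<\cdots<\pi_i$). $\operatorname{Av}(T)$ is the set of permutations avoiding every pattern in $T$. -}

module Defs where

open import Data.Nat using (ℕ; suc; _<_; _≤_; _<?_; _≤?_)
open import Data.Fin using (Fin; toℕ; cast)
open import Data.Fin.Properties using (all?)
open import Data.List using (List; []; _∷_; length; lookup; map; filter; allFin; upTo)
open import Data.List.Relation.Binary.Sublist.Propositional using (_⊆_)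
open import Data.List.Relation.Binary.Permutation.Propositional using (_↭_)
open import Data.Product using (Σ; ∃; _×_)
open import Function.Bundles using (_⇔_)
open import Relation.Nullary using (¬_; Dec; ¬?)
open import Relation.Nullary.Decidable using (_→-dec_)
open import Relation.Binary.PropositionalEquality using (_≡_)

IsPerm : List ℕ → Set
IsPerm xs = xs ↭ map suc (upTo (length xs))

OrderIso : List ℕ → List ℕ → Set
OrderIso xs ys = Σ (length xs ≡ length ys) λ eq →
  ∀ (i j : Fin (length xs)) →
    (lookup xs i < lookup xs j) ⇔ (lookup ys (cast eq i) < lookup ys (cast eq j))

Contains : List ℕ → List ℕ → Set
Contains π p = ∃ λ s → (s ⊆ π) × OrderIso s p

Avoids : List ℕ → List ℕ → Set
Avoids π p = ¬ Contains π p

LRMax : (π : List ℕ) → Fin (length π) → Set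
LRMax π i = ∀ (j : Fin (length π)) → toℕ j < toℕ i → lookup π j < lookup π i

LeadingMax : (π : List ℕ) → Fin (length π) → Set
LeadingMax π i = ∀ (j : Fin (length π)) → toℕ j ≤ toℕ i → LRMax π j

LRMax? : (π : List ℕ) → (i : Fin (length π)) → Dec (LRMax π i)
LRMax? π i = all? (λ j → (toℕ j <? toℕ i) →-dec (lookup π j <? lookup π i))

LeadingMax? : (π : List ℕ) → (i : Fin (length π)) → Dec (LeadingMax π i)
LeadingMax? π i = all? (λ j → (toℕ j ≤? toℕ i) →-dec LRMax? π j)

deleteLeadingMaxima : List ℕ → List ℕ
deleteLeadingMaxima π =
  map (lookup π) (filter (λ i → ¬? (LeadingMax? π i)) (allFin (length π)))

p2143 p3142 p4132 p132 : List ℕ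
p2143 = 2 ∷ 1 ∷ 4 ∷ 3 ∷ []
p3142 = 3 ∷ 1 ∷ 4 ∷ 2 ∷ []
p4132 = 4 ∷ 1 ∷ 3 ∷ 2 ∷ []
p132 = 1 ∷ 3 ∷ 2 ∷ []

module Submission where

-- The leading maxima of π are exactly its longest increasing prefix π₁ < ⋯ < πₖ, so deleting
-- them leaves the suffix τ = πₖ₊₁ ⋯ πₙ, which begins with the descent πₖ > πₖ₊₁.  Each of
-- 2143, 3142 and 4132 is an entry w followed by a 132 x z y with x < w; such an x is not a
-- leading maximum, so x z y is a 132 inside τ.  Conversely, for a 132 x z y inside τ the
-- descent πₖ > πₖ₊₁ yields an entry w before an entry x′ ≤ x with x′ < w and x′ z y still a
-- 132, and w < y, y < w < z or z < w produce 2143, 3142 or 4132.  Finally, relabelling the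
-- values of τ order-preservingly turns it into the required permutation σ.

open import Defs
open import Data.Bool using (true; false)
open import Data.Empty using (⊥-elim)
open import Data.Fin using (Fin; toℕ; cast; fromℕ<; #_) renaming (zero to fzero; suc to fsuc)
open import Data.Fin.Properties using (cast-involutive; toℕ-cast; toℕ-fromℕ<; toℕ<n)
open import Data.List
  using (List; []; _∷_; _++_; [_]; length; lookup; map; take; drop; filter; allFin; tabulate; upTo)
open import Data.List.Properties
  using ( length-map; length-take; map-tabulate; map-∘; map-++; map-id; map-id-local; upTo-∷ʳ
        ; filter-≐; take++drop≡id)
open import Data.List.Membership.Propositional using (_∈_)
open import Data.List.Membership.Propositional.Properties
  using (∈-lookup; ∈-map⁺; ∈-map⁻; ∈-upTo⁻; ∈-++⁺ʳ)
open import Data.List.Relation.Binary.Permutation.Propositional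
  using (_↭_; ↭-refl; ↭-sym; ↭⇒↭ₛ; module PermutationReasoning)
open import Data.List.Relation.Binary.Permutation.Propositional.Properties
  using (map⁺; ∈-resp-↭; ++⁺ʳ; ∷↭∷ʳ; drop-∷)
open import Data.List.Relation.Binary.Sublist.Propositional
  using (_⊆_; []; _∷_; _∷ʳ_; ⊆-refl; ⊆-trans; from∈)
open import Data.List.Relation.Binary.Sublist.Propositional.Properties using (∷ˡ⁻; All-resp-⊆)
open import Data.List.Relation.Unary.All using (All; []; _∷_; all?)
import Data.List.Relation.Unary.All as All
open import Data.List.Relation.Unary.AllPairs using (AllPairs; []; _∷_)
open import Data.List.Relation.Unary.Any using (here)
open import Data.List.Relation.Unary.Linked using (Linked; []; [-]; _∷_)
open import Data.List.Relation.Unary.Linked.Properties using (Linked⇒AllPairs)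
open import Data.List.Relation.Unary.Unique.Propositional using (Unique)
import Data.List.Relation.Unary.Unique.Propositional.Properties as Unique
open import Data.Nat
  using (ℕ; zero; suc; pred; _<_; _≤_; z≤n; s≤s; z<s; s<s; _<?_; _≤?_; s<s⁻¹; s≤s⁻¹)
open import Data.Nat.Properties
  using ( <-cmp; <-irrefl; <-asym; <-trans; <-≤-trans; ≤-<-trans; ≤-refl; ≤-reflexive; ≤-trans
        ; ≮⇒≥; <⇒≱; ≤∧≢⇒<; m≤n⇒m<n∨m≡n; n<1+n; n≤1+n; suc[m]≤n⇒m≤pred[n]; suc-injective; ⊓-glb)
open import Data.Product using (∃; _×_; _,_; proj₁; proj₂)
open import Data.Sum using (_⊎_; inj₁; inj₂)
import Data.Sum as Sum
open import Function.Base using (_∘_; id)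
open import Function.Bundles using (_⇔_; mk⇔; Equivalence)
import Function.Properties.Equivalence as ⇔
open import Relation.Binary.Definitions using (tri<; tri≈; tri>)
open import Relation.Binary.PropositionalEquality
  using (_≡_; _≢_; refl; sym; trans; cong; cong₂; subst; subst₂; setoid; module ≡-Reasoning)
open import Data.List.Relation.Binary.Permutation.Setoid.Properties (setoid ℕ) using (Unique-resp-↭)
open import Relation.Nullary using (¬_; Dec; yes; no; does)
open import Relation.Nullary.Decidable using (True; toWitness; _×-dec_)
open import Relation.Unary using (_≐_)

-- Returns 0 past the end.
at : List ℕ → ℕ → ℕ
at []       _       = 0
at (x ∷ xs) zero    = x
at (x ∷ xs) (suc i) = at xs i

lookup≡at : ∀ xs (i : Fin (length xs)) → lookup xs i ≡ at xs (toℕ i)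
lookup≡at (x ∷ xs) fzero    = refl
lookup≡at (x ∷ xs) (fsuc i) = lookup≡at xs i

lookup-fromℕ< : ∀ xs {i} (i<n : i < length xs) → lookup xs (fromℕ< i<n) ≡ at xs i
lookup-fromℕ< (x ∷ xs) {zero}  _   = refl
lookup-fromℕ< (x ∷ xs) {suc i} i<n = lookup-fromℕ< xs (s<s⁻¹ i<n)

at-take : ∀ xs {k i} → i < k → at (take k xs) i ≡ at xs i
at-take []       {suc k} {i}     _   = refl
at-take (x ∷ xs) {suc k} {zero}  _   = refl
at-take (x ∷ xs) {suc k} {suc i} i<k = at-take xs (s<s⁻¹ i<k)

at-increasing : ∀ {xs i j} → Linked _<_ xs → i < j → j < length xs → at xs i < at xs j
at-increasing {x ∷ y ∷ ys} {zero} {suc zero} (x<y ∷ _) _ _ = x<y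
at-increasing {x ∷ y ∷ ys} {zero} {suc (suc j)} (x<y ∷ y∷ys↑) _ j<n =
  <-trans x<y (at-increasing y∷ys↑ z<s (s<s⁻¹ j<n))
at-increasing {x ∷ y ∷ ys} {suc i} {suc j} (_ ∷ y∷ys↑) i<j j<n =
  at-increasing y∷ys↑ (s<s⁻¹ i<j) (s<s⁻¹ j<n)
at-increasing {_ ∷ []} {_} {suc _} [-] _ (s≤s ())

StrictOn : (ℕ → ℕ) → List ℕ → Set
StrictOn F xs = ∀ {x y} → x ∈ xs → y ∈ xs → x < y → F x < F y

strictOn⇒⇔ : ∀ {F xs x y} → StrictOn F xs → x ∈ xs → y ∈ xs → (x < y ⇔ F x < F y)
strictOn⇒⇔ {F} {x = x} {y} F↑ x∈ y∈ = mk⇔ (F↑ x∈ y∈) reflects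
  where
  reflects : F x < F y → x < y
  reflects Fx<Fy with <-cmp x y
  ... | tri< x<y _ _ = x<y
  ... | tri≈ _ refl _ = ⊥-elim (<-irrefl refl Fx<Fy)
  ... | tri> _ _ y<x = ⊥-elim (<-asym Fx<Fy (F↑ y∈ x∈ y<x))

lookup-map : ∀ (F : ℕ → ℕ) xs .(eq : length xs ≡ length (map F xs)) (i : Fin (length xs)) →
  lookup (map F xs) (cast eq i) ≡ F (lookup xs i)
lookup-map F (x ∷ xs) eq fzero    = refl
lookup-map F (x ∷ xs) eq (fsuc i) = lookup-map F xs _ i

orderIso-map : ∀ {F xs} → StrictOn F xs → OrderIso xs (map F xs)
orderIso-map {F} {xs} F↑ = eq , λ i j →
  subst₂ (λ u v → (lookup xs i < lookup xs j) ⇔ u < v)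
    (sym (lookup-map F xs eq i)) (sym (lookup-map F xs eq j))
    (strictOn⇒⇔ F↑ (∈-lookup i) (∈-lookup j))
  where
  eq = sym (length-map F xs)

orderIso-sym : ∀ {xs ys} → OrderIso xs ys → OrderIso ys xs
orderIso-sym {xs} {ys} (eq , iso) = sym eq , λ i j →
  subst₂ (λ u v → (lookup ys u < lookup ys v) ⇔ (lookup xs (cast eq⁻¹ i) < lookup xs (cast eq⁻¹ j)))
    (cast-involutive eq eq⁻¹ i) (cast-involutive eq eq⁻¹ j)
    (⇔.sym (iso (cast eq⁻¹ i) (cast eq⁻¹ j)))
  where
  eq⁻¹ = sym eq

-- Entry r of p is replaced by the r-th smallest of the values vs; the side condition (entries of
-- p lie in 1 … length vs) is discharged by evaluation when p is a literal.
orderIso-instantiate : ∀ {vs} → Linked _<_ vs → (p : List ℕ) →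
  {True (all? (λ r → (1 ≤? r) ×-dec (r ≤? length vs)) p)} →
  OrderIso (map (at vs ∘ pred) p) p
orderIso-instantiate {vs} vs↑ p {inRange} =
  orderIso-sym {p} {map (at vs ∘ pred) p} (orderIso-map increasing)
  where
  bounds = All.lookup (toWitness inRange)
  increasing : StrictOn (at vs ∘ pred) p
  increasing r∈ r′∈ r<r′ with bounds r∈ | bounds r′∈
  ... | s≤s _ , _ | s≤s _ , r′≤n = at-increasing vs↑ (s<s⁻¹ r<r′) r′≤n

orderIso-reflects : ∀ {s p} ((eq , _) : OrderIso s p) (i j : Fin (length s)) →
  {True (lookup p (cast eq i) <? lookup p (cast eq j))} → lookup s i < lookup s j
orderIso-reflects (_ , iso) i j {lt} = Equivalence.from (iso i j) (toWitness lt)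

Contains-resp-⊆ : ∀ {xs ys p} → xs ⊆ ys → Contains xs p → Contains ys p
Contains-resp-⊆ xs⊆ys (s , s⊆xs , s≅p) = s , ⊆-trans s⊆xs xs⊆ys , s≅p

contains132⁺ : ∀ {xs a b c} → (a ∷ b ∷ c ∷ []) ⊆ xs → a < c → c < b → Contains xs p132
contains132⁺ s⊆xs a<c c<b = _ , s⊆xs , orderIso-instantiate (a<c ∷ c<b ∷ [-]) p132

contains132⁻ : ∀ {xs} → Contains xs p132 →
  ∃ λ a → ∃ λ b → ∃ λ c → (a ∷ b ∷ c ∷ []) ⊆ xs × a < c × c < b
contains132⁻ (a ∷ b ∷ c ∷ [] , s⊆xs , o) =
  a , b , c , s⊆xs , orderIso-reflects o (# 0) (# 2) , orderIso-reflects o (# 2) (# 1)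

contains2143⁺ : ∀ {xs a b c d} → (a ∷ b ∷ c ∷ d ∷ []) ⊆ xs → b < a → a < d → d < c →
  Contains xs p2143
contains2143⁺ s⊆xs b<a a<d d<c = _ , s⊆xs , orderIso-instantiate (b<a ∷ a<d ∷ d<c ∷ [-]) p2143

contains2143⁻ : ∀ {xs} → Contains xs p2143 →
  ∃ λ a → ∃ λ b → ∃ λ c → ∃ λ d → (a ∷ b ∷ c ∷ d ∷ []) ⊆ xs × b < a × a < d × d < c
contains2143⁻ (a ∷ b ∷ c ∷ d ∷ [] , s⊆xs , o) =
  a , b , c , d , s⊆xs
  , orderIso-reflects o (# 1) (# 0) , orderIso-reflects o (# 0) (# 3) , orderIso-reflects o (# 3) (# 2)

contains3142⁺ : ∀ {xs a b c d} → (a ∷ b ∷ c ∷ d ∷ []) ⊆ xs → b < d → d < a → a < c →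
  Contains xs p3142
contains3142⁺ s⊆xs b<d d<a a<c = _ , s⊆xs , orderIso-instantiate (b<d ∷ d<a ∷ a<c ∷ [-]) p3142

contains3142⁻ : ∀ {xs} → Contains xs p3142 →
  ∃ λ a → ∃ λ b → ∃ λ c → ∃ λ d → (a ∷ b ∷ c ∷ d ∷ []) ⊆ xs × b < d × d < a × a < c
contains3142⁻ (a ∷ b ∷ c ∷ d ∷ [] , s⊆xs , o) =
  a , b , c , d , s⊆xs
  , orderIso-reflects o (# 1) (# 3) , orderIso-reflects o (# 3) (# 0) , orderIso-reflects o (# 0) (# 2)

contains4132⁺ : ∀ {xs a b c d} → (a ∷ b ∷ c ∷ d ∷ []) ⊆ xs → b < d → d < c → c < a →
  Contains xs p4132
contains4132⁺ s⊆xs b<d d<c c<a = _ , s⊆xs , orderIso-instantiate (b<d ∷ d<c ∷ c<a ∷ [-]) p4132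

contains4132⁻ : ∀ {xs} → Contains xs p4132 →
  ∃ λ a → ∃ λ b → ∃ λ c → ∃ λ d → (a ∷ b ∷ c ∷ d ∷ []) ⊆ xs × b < d × d < c × c < a
contains4132⁻ (a ∷ b ∷ c ∷ d ∷ [] , s⊆xs , o) =
  a , b , c , d , s⊆xs
  , orderIso-reflects o (# 1) (# 3) , orderIso-reflects o (# 3) (# 2) , orderIso-reflects o (# 2) (# 0)

⊆-position₁ : ∀ {xs : List ℕ} {c} → (c ∷ []) ⊆ xs → ∃ λ l → lookup xs l ≡ c
⊆-position₁ (y ∷ʳ s) with ⊆-position₁ s
... | l , refl = fsuc l , refl
⊆-position₁ (refl ∷ _) = fzero , refl

⊆-positions₂ : ∀ {xs : List ℕ} {b c} → (b ∷ c ∷ []) ⊆ xs →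
  ∃ λ j → ∃ λ l → toℕ j < toℕ l × lookup xs j ≡ b × lookup xs l ≡ c
⊆-positions₂ (y ∷ʳ s) with ⊆-positions₂ s
... | j , l , j<l , refl , refl = fsuc j , fsuc l , s<s j<l , refl , refl
⊆-positions₂ (refl ∷ s) with ⊆-position₁ s
... | l , refl = fzero , fsuc l , z<s , refl , refl

⊆-positions₃ : ∀ {xs : List ℕ} {a b c} → (a ∷ b ∷ c ∷ []) ⊆ xs →
  ∃ λ i → ∃ λ j → ∃ λ l → toℕ i < toℕ j × toℕ j < toℕ l ×
    lookup xs i ≡ a × lookup xs j ≡ b × lookup xs l ≡ c
⊆-positions₃ (y ∷ʳ s) with ⊆-positions₃ s
... | i , j , l , i<j , j<l , refl , refl , refl =
  fsuc i , fsuc j , fsuc l , s<s i<j , s<s j<l , refl , refl , refl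
⊆-positions₃ (refl ∷ s) with ⊆-positions₂ s
... | j , l , j<l , refl , refl = fzero , fsuc j , fsuc l , z<s , s<s j<l , refl , refl , refl

positions₂-⊆ : ∀ {ys : List ℕ} (j l : Fin (length ys)) → toℕ j < toℕ l →
  (lookup ys j ∷ lookup ys l ∷ []) ⊆ ys
positions₂-⊆ {y ∷ ys} fzero    (fsuc l) _   = refl ∷ from∈ (∈-lookup l)
positions₂-⊆ {y ∷ ys} (fsuc j) (fsuc l) j<l = y ∷ʳ positions₂-⊆ j l (s<s⁻¹ j<l)

positions₃-⊆ : ∀ {ys : List ℕ} (i j l : Fin (length ys)) → toℕ i < toℕ j → toℕ j < toℕ l →
  (lookup ys i ∷ lookup ys j ∷ lookup ys l ∷ []) ⊆ ys
positions₃-⊆ {y ∷ ys} fzero    (fsuc j) (fsuc l) _   j<l = refl ∷ positions₂-⊆ j l (s<s⁻¹ j<l)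
positions₃-⊆ {y ∷ ys} (fsuc i) (fsuc j) (fsuc l) i<j j<l =
  y ∷ʳ positions₃-⊆ i j l (s<s⁻¹ i<j) (s<s⁻¹ j<l)

contains132-transport : ∀ {xs ys} → OrderIso xs ys → Contains xs p132 → Contains ys p132
contains132-transport {xs} {ys} (eq , iso) xs⊇132 with contains132⁻ xs⊇132
... | _ , _ , _ , s , a<c , c<b = at-positions (⊆-positions₃ s) a<c c<b
  where
  cast-< : ∀ {u v} → toℕ u < toℕ v → toℕ (cast eq u) < toℕ (cast eq v)
  cast-< {u} {v} = subst₂ _<_ (sym (toℕ-cast eq u)) (sym (toℕ-cast eq v))
  at-positions : ∀ {a b c} → (∃ λ i → ∃ λ j → ∃ λ l → toℕ i < toℕ j × toℕ j < toℕ l ×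
                   lookup xs i ≡ a × lookup xs j ≡ b × lookup xs l ≡ c) →
                 a < c → c < b → Contains ys p132
  at-positions (i , j , l , i<j , j<l , refl , refl , refl) a<c c<b =
    contains132⁺ (positions₃-⊆ (cast eq i) (cast eq j) (cast eq l) (cast-< i<j) (cast-< j<l))
      (Equivalence.to (iso i l) a<c) (Equivalence.to (iso l j) c<b)

-- A descent in front of a 132

ContainsForbidden : List ℕ → Set
ContainsForbidden xs = Contains xs p2143 ⊎ Contains xs p3142 ⊎ Contains xs p4132

ContainsForbidden-resp-⊆ : ∀ {xs ys} → xs ⊆ ys → ContainsForbidden xs → ContainsForbidden ys
ContainsForbidden-resp-⊆ xs⊆ys =
  Sum.map (Contains-resp-⊆ xs⊆ys) (Sum.map (Contains-resp-⊆ xs⊆ys) (Contains-resp-⊆ xs⊆ys))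

forbidden⇒descent-132 : ∀ {xs} → ContainsForbidden xs →
  ∃ λ w → ∃ λ x → ∃ λ z → ∃ λ y → (w ∷ x ∷ z ∷ y ∷ []) ⊆ xs × x < w × x < y × y < z
forbidden⇒descent-132 (inj₁ xs⊇2143) with contains2143⁻ xs⊇2143
... | a , b , c , d , s , b<a , a<d , d<c = a , b , c , d , s , b<a , <-trans b<a a<d , d<c
forbidden⇒descent-132 (inj₂ (inj₁ xs⊇3142)) with contains3142⁻ xs⊇3142
... | a , b , c , d , s , b<d , d<a , a<c = a , b , c , d , s , <-trans b<d d<a , b<d , <-trans d<a a<c
forbidden⇒descent-132 (inj₂ (inj₂ xs⊇4132)) with contains4132⁻ xs⊇4132
... | a , b , c , d , s , b<d , d<c , c<a = a , b , c , d , s , <-trans b<d (<-trans d<c c<a) , b<d , d<c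

Unique-resp-⊆ : ∀ {xs ys : List ℕ} → xs ⊆ ys → Unique ys → Unique xs
Unique-resp-⊆ []         []            = []
Unique-resp-⊆ (_ ∷ʳ xs⊆) (_ ∷ ys!)     = Unique-resp-⊆ xs⊆ ys!
Unique-resp-⊆ (refl ∷ xs⊆) (y∉ ∷ ys!) = All-resp-⊆ xs⊆ y∉ ∷ Unique-resp-⊆ xs⊆ ys!

descent-132⇒forbidden : ∀ {xs w x z y} → Unique xs → (w ∷ x ∷ z ∷ y ∷ []) ⊆ xs →
  x < w → x < y → y < z → ContainsForbidden xs
descent-132⇒forbidden {w = w} {z = z} {y} xs! s x<w x<y y<z with Unique-resp-⊆ s xs!
... | (_ ∷ w≢z ∷ w≢y ∷ []) ∷ _ with <-cmp w y
...   | tri< w<y _ _ = inj₁ (contains2143⁺ s x<w w<y y<z)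
...   | tri≈ _ w≡y _ = ⊥-elim (w≢y w≡y)
...   | tri> _ _ y<w with <-cmp w z
...     | tri< w<z _ _ = inj₂ (inj₁ (contains3142⁺ s x<y y<w w<z))
...     | tri≈ _ w≡z _ = ⊥-elim (w≢z w≡z)
...     | tri> _ _ z<w = inj₂ (inj₂ (contains4132⁺ s x<y y<z z<w))

-- w is t if the 132 starts below t; otherwise w is L and t replaces the first entry of the 132.
132-after-descent⇒forbidden : ∀ {L t τ x z y} → Unique (L ∷ t ∷ τ) → t < L →
  (x ∷ z ∷ y ∷ []) ⊆ (t ∷ τ) → x < y → y < z → ContainsForbidden (L ∷ t ∷ τ)
132-after-descent⇒forbidden u t<L (refl ∷ s) x<y y<z =
  descent-132⇒forbidden u (refl ∷ refl ∷ s) t<L x<y y<z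
132-after-descent⇒forbidden {L} {t} {x = x} u t<L (_ ∷ʳ s) x<y y<z with <-cmp t x
... | tri< t<x _ _ = descent-132⇒forbidden u (refl ∷ refl ∷ ∷ˡ⁻ s) t<L (<-trans t<x x<y) y<z
... | tri> _ _ x<t = descent-132⇒forbidden u (L ∷ʳ refl ∷ s) x<t x<y y<z
... | tri≈ _ t≡x _ with Unique-resp-⊆ (L ∷ʳ refl ∷ s) u
...   | (t≢x ∷ _) ∷ _ = ⊥-elim (t≢x t≡x)

below-⊆-suffix : ∀ {x : ℕ} {r} pre {τ} → All (x <_) pre → (x ∷ r) ⊆ pre ++ τ → (x ∷ r) ⊆ τ
below-⊆-suffix []        _           s          = s
below-⊆-suffix (p ∷ pre) (_ ∷ x<pre) (_ ∷ʳ s)   = below-⊆-suffix pre x<pre s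
below-⊆-suffix (p ∷ pre) (x<x ∷ _)   (refl ∷ _) = ⊥-elim (<-irrefl refl x<x)

descent-⊆-suffix : ∀ {w x : ℕ} {r} pre {τ} → AllPairs _<_ pre →
  (w ∷ x ∷ r) ⊆ pre ++ τ → x < w → (x ∷ r) ⊆ τ
descent-⊆-suffix []        _            s          _   = ∷ˡ⁻ s
descent-⊆-suffix (p ∷ pre) (_ ∷ pre↑)   (_ ∷ʳ s)   x<w = descent-⊆-suffix pre pre↑ s x<w
descent-⊆-suffix (p ∷ pre) (w<pre ∷ _)  (refl ∷ s) x<w =
  below-⊆-suffix pre (All.map (<-trans x<w) w<pre) s

-- Leading maxima form the longest increasing prefix

ascentAfter : ℕ → List ℕ → ℕ
ascentAfter x []       = 0
ascentAfter x (y ∷ ys) with x <? y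
... | yes _ = suc (ascentAfter y ys)
... | no  _ = 0

ascentLength : List ℕ → ℕ
ascentLength []       = 0
ascentLength (x ∷ xs) = suc (ascentAfter x xs)

ascent-increasing : ∀ π → Linked _<_ (take (ascentLength π) π)
ascent-increasing []       = []
ascent-increasing (x ∷ xs) = go x xs
  where
  go : ∀ x xs → Linked _<_ (x ∷ take (ascentAfter x xs) xs)
  go x []       = [-]
  go x (y ∷ ys) with x <? y
  ... | yes x<y = x<y ∷ go y ys
  ... | no  _   = [-]

ascent-ends : ∀ x xs → ascentAfter x xs < length xs →
  ¬ (at (x ∷ xs) (ascentAfter x xs) < at xs (ascentAfter x xs))
ascent-ends x (y ∷ ys) m<n with x <? y
... | yes _   = ascent-ends y ys (s<s⁻¹ m<n)
... | no  x≮y = x≮y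

ascent-descent : ∀ x xs {t τ} → drop (ascentAfter x xs) xs ≡ t ∷ τ →
  ∃ λ L → (L ∷ t ∷ τ) ⊆ (x ∷ xs) × ¬ L < t
ascent-descent x (y ∷ ys) eq with x <? y
ascent-descent x (y ∷ ys) eq | yes _ with ascent-descent y ys eq
... | L , s , L≮t = L , x ∷ʳ s , L≮t
ascent-descent x (y ∷ ys) refl | no x≮y = x , ⊆-refl , x≮y

ascent-at-increasing : ∀ π {j′ j} → j′ < j → j < ascentLength π → j < length π → at π j′ < at π j
ascent-at-increasing π {j′} {j} j′<j j<k j<n =
  subst₂ _<_ (at-take π (<-trans j′<j j<k)) (at-take π j<k)
    (at-increasing (ascent-increasing π) j′<j
      (subst (j <_) (sym (length-take (ascentLength π) π)) (⊓-glb j<k j<n)))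

leadingMax-at-increasing : ∀ π (i : Fin (length π)) → LeadingMax π i →
  ∀ {j′ j} → j′ < j → j ≤ toℕ i → at π j′ < at π j
leadingMax-at-increasing π i lm {j′} {j} j′<j j≤i =
  subst₂ _<_ (lookup-fromℕ< π j′<n) (lookup-fromℕ< π j<n)
    (lm (fromℕ< j<n) (subst (_≤ toℕ i) (sym (toℕ-fromℕ< j<n)) j≤i) (fromℕ< j′<n)
      (subst₂ _<_ (sym (toℕ-fromℕ< j′<n)) (sym (toℕ-fromℕ< j<n)) j′<j))
  where
  j<n = ≤-<-trans j≤i (toℕ<n i)
  j′<n = <-trans j′<j j<n

leadingMax⇔ : ∀ π (i : Fin (length π)) → LeadingMax π i ⇔ toℕ i < ascentLength π
leadingMax⇔ π i = mk⇔ (⇒ π i) ⇐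
  where
  ⇐ : toℕ i < ascentLength π → LeadingMax π i
  ⇐ i<k j j≤i j′ j′<j = subst₂ _<_ (sym (lookup≡at π j′)) (sym (lookup≡at π j))
    (ascent-at-increasing π j′<j (≤-<-trans j≤i i<k) (toℕ<n j))
  ⇒ : ∀ π (i : Fin (length π)) → LeadingMax π i → toℕ i < ascentLength π
  ⇒ (x ∷ xs) i lm with toℕ i <? suc (ascentAfter x xs)
  ... | yes i<k = i<k
  ... | no  i≮k = ⊥-elim (ascent-ends x xs m<n (leadingMax-at-increasing (x ∷ xs) i lm (n<1+n _) k≤i))
    where
    k≤i = ≮⇒≥ i≮k
    m<n = s<s⁻¹ (≤-<-trans k≤i (toℕ<n i))

filter-map : ∀ {A B : Set} {P : B → Set} (P? : ∀ y → Dec (P y)) (f : A → B) xs →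
  filter P? (map f xs) ≡ map f (filter (P? ∘ f) xs)
filter-map P? f []       = refl
filter-map P? f (x ∷ xs) with does (P? (f x))
... | true  = cong (f x ∷_) (filter-map P? f xs)
... | false = filter-map P? f xs

map-lookup-filter-≤ : ∀ (xs : List ℕ) k →
  map (lookup xs) (filter (λ i → k ≤? toℕ i) (allFin (length xs))) ≡ drop k xs

map-lookup-filter-≤-tail : ∀ x (xs : List ℕ) k →
  map (lookup (x ∷ xs)) (filter (λ i → k ≤? toℕ i) (tabulate fsuc)) ≡ drop (pred k) xs
map-lookup-filter-≤-tail x xs k = begin
  map (lookup (x ∷ xs)) (filter P? (tabulate fsuc))
    ≡⟨ cong (map (lookup (x ∷ xs)) ∘ filter P?) (sym (map-tabulate id fsuc)) ⟩
  map (lookup (x ∷ xs)) (filter P? (map fsuc (allFin n)))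
    ≡⟨ cong (map (lookup (x ∷ xs))) (filter-map P? fsuc (allFin n)) ⟩
  map (lookup (x ∷ xs)) (map fsuc (filter (P? ∘ fsuc) (allFin n)))
    ≡⟨ sym (map-∘ (filter (P? ∘ fsuc) (allFin n))) ⟩
  map (lookup xs) (filter (P? ∘ fsuc) (allFin n))
    ≡⟨ cong (map (lookup xs)) (filter-≐ (P? ∘ fsuc) (λ i → pred k ≤? toℕ i) (shift k) (allFin n)) ⟩
  map (lookup xs) (filter (λ i → pred k ≤? toℕ i) (allFin n))
    ≡⟨ map-lookup-filter-≤ xs (pred k) ⟩
  drop (pred k) xs ∎
  where
  open ≡-Reasoning
  n = length xs
  P? = λ (i : Fin (suc n)) → k ≤? toℕ i
  shift : ∀ k → (λ (i : Fin n) → k ≤ suc (toℕ i)) ≐ (λ i → pred k ≤ toℕ i)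
  shift zero    = (λ _ → z≤n) , (λ _ → z≤n)
  shift (suc k) = s≤s⁻¹ , s≤s

map-lookup-filter-≤ []       zero    = refl
map-lookup-filter-≤ []       (suc k) = refl
map-lookup-filter-≤ (x ∷ xs) zero    = cong (x ∷_) (map-lookup-filter-≤-tail x xs zero)
map-lookup-filter-≤ (x ∷ xs) (suc k) = map-lookup-filter-≤-tail x xs (suc k)

deleteLeadingMaxima≡drop : ∀ π → deleteLeadingMaxima π ≡ drop (ascentLength π) π
deleteLeadingMaxima≡drop π =
  trans (cong (map (lookup π)) (filter-≐ _ (λ i → k ≤? toℕ i) notLeading≐ (allFin (length π))))
    (map-lookup-filter-≤ π k)
  where
  k = ascentLength π
  notLeading≐ : (λ i → ¬ LeadingMax π i) ≐ (λ i → k ≤ toℕ i)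
  notLeading≐ = (λ {i} ¬lm → ≮⇒≥ (¬lm ∘ Equivalence.from (leadingMax⇔ π i)))
              , (λ {i} k≤i lm → <⇒≱ (Equivalence.to (leadingMax⇔ π i) lm) k≤i)

-- Standardisation

oneTo : ℕ → List ℕ
oneTo n = map suc (upTo n)

oneTo-suc : ∀ n → oneTo (suc n) ≡ oneTo n ++ [ suc n ]
oneTo-suc n = trans (cong (map suc) (sym (upTo-∷ʳ n))) (map-++ suc (upTo n) [ n ])

∈-oneTo⁻ : ∀ {x n} → x ∈ oneTo n → 1 ≤ x × x ≤ n
∈-oneTo⁻ x∈ with ∈-map⁻ suc x∈
... | _ , y∈ , refl = s≤s z≤n , ∈-upTo⁻ y∈

IsPerm⇒Unique : ∀ {xs} → IsPerm xs → Unique xs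
IsPerm⇒Unique xs↭ =
  Unique-resp-↭ (↭⇒↭ₛ (↭-sym xs↭)) (Unique.map⁺ suc-injective (Unique.upTo⁺ _))

-- Relabels the values of a permutation after the value a has been removed.
closeGap : ℕ → ℕ → ℕ
closeGap a x with a <? x
... | yes _ = pred x
... | no  _ = x

closeGap-≤ : ∀ {a x} → x ≤ a → closeGap a x ≡ x
closeGap-≤ {a} {x} x≤a with a <? x
... | yes a<x = ⊥-elim (<⇒≱ a<x x≤a)
... | no  _   = refl

closeGap-> : ∀ {a x} → a < x → closeGap a x ≡ pred x
closeGap-> {a} {x} a<x with a <? x
... | yes _   = refl
... | no  a≮x = ⊥-elim (a≮x a<x)

closeGap-< : ∀ {a x y} → x ≢ a → x < y → closeGap a x < closeGap a y
closeGap-< {a} {x} {y} x≢a x<y with a <? x | a <? y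
... | yes a<x | yes _   = pred-< a<x x<y
  where
  pred-< : ∀ {a x y} → a < x → x < y → pred x < pred y
  pred-< (s≤s _) (s≤s x<y) = x<y
... | yes a<x | no  a≮y = ⊥-elim (a≮y (<-trans a<x x<y))
... | no  a≮x | yes a<y = <-≤-trans (≤∧≢⇒< (≮⇒≥ a≮x) x≢a) (suc[m]≤n⇒m≤pred[n] a<y)
... | no  _   | no  _   = x<y

closeGap-oneTo : ∀ n {a} → 1 ≤ a → a ≤ suc n → map (closeGap a) (oneTo (suc n)) ↭ a ∷ oneTo n
closeGap-oneTo zero    {suc zero}    _   _          = ↭-refl
closeGap-oneTo zero    {suc (suc _)} _   (s≤s ())
closeGap-oneTo (suc m) {a}           1≤a a≤2+m = begin
  map cg (oneTo (suc (suc m)))                    ≡⟨ cong (map cg) (oneTo-suc (suc m)) ⟩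
  map cg (oneTo (suc m) ++ [ suc (suc m) ])       ≡⟨ map-++ cg (oneTo (suc m)) _ ⟩
  map cg (oneTo (suc m)) ++ [ cg (suc (suc m)) ]  ↭⟨ last (m≤n⇒m<n∨m≡n a≤2+m) ⟩
  a ∷ oneTo (suc m)                               ∎
  where
  open PermutationReasoning
  cg = closeGap a
  last : a < suc (suc m) ⊎ a ≡ suc (suc m) → map cg (oneTo (suc m)) ++ [ cg (suc (suc m)) ] ↭ a ∷ oneTo (suc m)
  last (inj₁ (s≤s a≤1+m)) = begin
    map cg (oneTo (suc m)) ++ [ cg (suc (suc m)) ] ≡⟨ cong (λ x → map cg (oneTo (suc m)) ++ [ x ]) (closeGap-> (s≤s a≤1+m)) ⟩
    map cg (oneTo (suc m)) ++ [ suc m ]            ↭⟨ ++⁺ʳ [ suc m ] (closeGap-oneTo m 1≤a a≤1+m) ⟩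
    a ∷ oneTo m ++ [ suc m ]                       ≡⟨ cong (a ∷_) (sym (oneTo-suc m)) ⟩
    a ∷ oneTo (suc m)                              ∎
  last (inj₂ a≡2+m) = begin
    map cg (oneTo (suc m)) ++ [ cg (suc (suc m)) ] ≡⟨ cong₂ (λ xs x → xs ++ [ x ]) (map-id-local (All.tabulate below)) top ⟩
    oneTo (suc m) ++ [ a ]                         ↭⟨ ↭-sym (∷↭∷ʳ a (oneTo (suc m))) ⟩
    a ∷ oneTo (suc m)                              ∎
    where
    top : cg (suc (suc m)) ≡ a
    top = trans (closeGap-≤ (≤-reflexive (sym a≡2+m))) (sym a≡2+m)
    below : ∀ {x} → x ∈ oneTo (suc m) → cg x ≡ x
    below x∈ = closeGap-≤ (≤-trans (proj₂ (∈-oneTo⁻ x∈)) (≤-trans (n≤1+n _) (≤-reflexive (sym a≡2+m))))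

IsPerm-closeGap : ∀ a xs → IsPerm (a ∷ xs) → IsPerm (map (closeGap a) xs)
IsPerm-closeGap a xs a∷xs↭ =
  subst (map (closeGap a) xs ↭_) (cong oneTo (sym (length-map (closeGap a) xs))) (drop-∷ (begin
    a ∷ map (closeGap a) xs           ≡⟨ cong (_∷ map (closeGap a) xs) (sym (closeGap-≤ ≤-refl)) ⟩
    map (closeGap a) (a ∷ xs)         ↭⟨ map⁺ (closeGap a) a∷xs↭ ⟩
    map (closeGap a) (oneTo (suc n))  ↭⟨ closeGap-oneTo n (proj₁ a-bounds) (proj₂ a-bounds) ⟩
    a ∷ oneTo n                       ∎))
  where
  open PermutationReasoning
  n = length xs
  a-bounds = ∈-oneTo⁻ (∈-resp-↭ a∷xs↭ (here refl))

-- The entries of pre are removed one at a time by closeGap, which also relabels the rest of pre;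
-- hence the recursion on the length of pre.
standardise : ∀ pre τ → IsPerm (pre ++ τ) → ∃ λ F → StrictOn F τ × IsPerm (map F τ)
standardise pre τ = go (length pre) pre τ refl
  where
  go : ∀ n pre τ → length pre ≡ n → IsPerm (pre ++ τ) → ∃ λ F → StrictOn F τ × IsPerm (map F τ)
  go _ [] τ _ τ↭ = id , (λ _ _ x<y → x<y) , subst IsPerm (sym (map-id τ)) τ↭
  go (suc n) (a ∷ pre) τ |pre|≡ a∷pre++τ↭
    with go n (map (closeGap a) pre) (map (closeGap a) τ)
            (trans (length-map (closeGap a) pre) (suc-injective |pre|≡))
            (subst IsPerm (map-++ (closeGap a) pre τ) (IsPerm-closeGap a (pre ++ τ) a∷pre++τ↭))
  ... | F , F↑ , Fτ↭ = F ∘ closeGap a , strict , subst IsPerm (sym (map-∘ τ)) Fτ↭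
    where
    ≢a : ∀ {x} → x ∈ τ → x ≢ a
    ≢a x∈ x≡a with IsPerm⇒Unique a∷pre++τ↭
    ... | a∉ ∷ _ = All.lookup a∉ (∈-++⁺ʳ pre x∈) (sym x≡a)
    strict : StrictOn (F ∘ closeGap a) τ
    strict x∈ y∈ x<y = F↑ (∈-map⁺ (closeGap a) x∈) (∈-map⁺ (closeGap a) y∈) (closeGap-< (≢a x∈) x<y)

drop-standardisable : ∀ k π → IsPerm π → ∃ λ σ → IsPerm σ × OrderIso (drop k π) σ
drop-standardisable k π π↭
  with standardise (take k π) (drop k π) (subst IsPerm (sym (take++drop≡id k π)) π↭)
... | F , F↑ , σ↭ = map F (drop k π) , σ↭ , orderIso-map F↑

132-after-ascent⇒forbidden : ∀ π {a b c} → Unique π → (a ∷ b ∷ c ∷ []) ⊆ drop (ascentLength π) π →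
  a < c → c < b → ContainsForbidden π
132-after-ascent⇒forbidden (x ∷ xs) π! s a<c c<b with drop (ascentAfter x xs) xs in eq
132-after-ascent⇒forbidden (x ∷ xs) π! () a<c c<b | []
132-after-ascent⇒forbidden (x ∷ xs) π! s a<c c<b | t ∷ τ with ascent-descent x xs eq
... | L , Ltτ⊆π , L≮t = ContainsForbidden-resp-⊆ Ltτ⊆π (132-after-descent⇒forbidden Ltτ! t<L s a<c c<b)
  where
  Ltτ! = Unique-resp-⊆ Ltτ⊆π π!
  t<L : t < L
  t<L with Ltτ!
  ... | (L≢t ∷ _) ∷ _ = ≤∧≢⇒< (≮⇒≥ L≮t) (L≢t ∘ sym)

deleteLeadingMaxima-132⇒forbidden : ∀ π → IsPerm π → Contains (deleteLeadingMaxima π) p132 →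
  ContainsForbidden π
deleteLeadingMaxima-132⇒forbidden π π↭ π′⊇132
  with contains132⁻ (subst (λ xs → Contains xs p132) (deleteLeadingMaxima≡drop π) π′⊇132)
... | _ , _ , _ , s , a<c , c<b = 132-after-ascent⇒forbidden π (IsPerm⇒Unique π↭) s a<c c<b

descent-132⇒deleteLeadingMaxima-132 : ∀ π {w x z y} → (w ∷ x ∷ z ∷ y ∷ []) ⊆ π →
  x < w → x < y → y < z → Contains (deleteLeadingMaxima π) p132
descent-132⇒deleteLeadingMaxima-132 π {w} {x} {z} {y} s x<w x<y y<z =
  subst (λ xs → Contains xs p132) (sym (deleteLeadingMaxima≡drop π))
    (contains132⁺ (descent-⊆-suffix (take k π) (Linked⇒AllPairs <-trans (ascent-increasing π))
                    (subst ((w ∷ x ∷ z ∷ y ∷ []) ⊆_) (sym (take++drop≡id k π)) s) x<w)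
                  x<y y<z)
  where
  k = ascentLength π

lemma4 : (π : List ℕ) → IsPerm π →
    ((Avoids π p2143 × Avoids π p3142 × Avoids π p4132)
      ⇔ (∃ λ σ → IsPerm σ × Avoids σ p132 × OrderIso (deleteLeadingMaxima π) σ))
lemma4 π π↭ = mk⇔ forward backward
  where
  forward : Avoids π p2143 × Avoids π p3142 × Avoids π p4132 →
    ∃ λ σ → IsPerm σ × Avoids σ p132 × OrderIso (deleteLeadingMaxima π) σ
  forward (π⊉2143 , π⊉3142 , π⊉4132) with drop-standardisable (ascentLength π) π π↭
  ... | σ , σ↭ , π′≅σ = σ , σ↭ , σ⊉132 , π′≅σ′
    where
    π′≅σ′ = subst (λ xs → OrderIso xs σ) (sym (deleteLeadingMaxima≡drop π)) π′≅σ
    σ⊉132 : Avoids σ p132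
    σ⊉132 = Sum.[ π⊉2143 , Sum.[ π⊉3142 , π⊉4132 ] ] ∘ deleteLeadingMaxima-132⇒forbidden π π↭
          ∘ contains132-transport (orderIso-sym {deleteLeadingMaxima π} {σ} π′≅σ′)
  backward : (∃ λ σ → IsPerm σ × Avoids σ p132 × OrderIso (deleteLeadingMaxima π) σ) →
    Avoids π p2143 × Avoids π p3142 × Avoids π p4132
  backward (σ , _ , σ⊉132 , π′≅σ) = π⊉ ∘ inj₁ , π⊉ ∘ inj₂ ∘ inj₁ , π⊉ ∘ inj₂ ∘ inj₂
    where
    π⊉ : ¬ ContainsForbidden π
    π⊉ π⊇ with forbidden⇒descent-132 π⊇
    ... | _ , _ , _ , _ , s , x<w , x<y , y<z =
      σ⊉132 (contains132-transport π′≅σ (descent-132⇒deleteLeadingMaxima-132 π s x<w x<y y<z))
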